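{- Let $H=(V,E)$ be a hypergraph with $n$ vertices and edge family $(e_i)_{i\in I}$, all hyperedges nonempty. Then $\xi(H;x,0,z,\mathbf{t})=\mu(H;x,(z\,t_i)_{i\in I})$ (with the convention $0^0=1$).
   Context: A hypergraph $H=(V,E)$ has finite vertex set $V$ and finite indexed family $E=(e_i)_{i\in I}$ of subsets of $V$ (parallel edges allowed); here all hyperedges are nonempty. For $J\subseteq I$, $H_J=(V,(e_j)_{j\in J})$ is the partial hypergraph and $H\times J$ the edge section hypergraph with vertex set $\bigcup_{j\in J}e_j$ and edges $(e_j)_{j\in J}$. $k(G)$ denotes the number of connected components of a hypergraph $G$ (a hypergraph without vertices has $0$). A pair $(A,B)$ of disjoint subsets of $I$ is vertex disjoint if $e_a\cap e_b=\emptyset$ for all $a\in A,b\in B$. The multivariate hyperedge elimination polynomial is $\xi(H;x,y,z,\mathbf{t})=\sum_{(A,B)}x^{k(H_{A\sqcup B})-k(H\times B)}y^{|A|+|B|-k(H\times B)}z^{k(H\times B)}\prod_{i\in A\sqcup B}t_i$, summed over vertex disjoint pairs. A matching is a set $M\subseteq I$ with $e_i\cap e_j=\emptyset$ for all distinct $i,j\in M$; $m_*(M)=\sum_{i\in M}|e_i|$. The multivariate matching polynomial is $\mu(H;x,\mathbf{y})=\sum_M x^{n-m_*(M)}\prod_{i\in M}y_i$, summed over all matchings. -}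

module Defs where

open import Level using (Level)
open import Data.Bool using (Bool; true; false; if_then_else_; _∧_; _∨_; not)
open import Data.Nat using (ℕ; zero; suc; _+_; _∸_; _<ᵇ_)
open import Data.Fin using (Fin; toℕ; _≟_)
open import Data.Fin.Subset using (Subset; inside; outside; _∪_; _∩_; ⁅_⁆; ∣_∣; ⊥)
open import Data.Vec using (Vec; []; _∷_; lookup)
open import Data.List using (List; []; _∷_; map; _++_; foldr; allFin; filter; length; concatMap)
open import Relation.Nullary.Decidable using (⌊_⌋)
open import Algebra.Bundles using (CommutativeSemiring)

-- A hypergraph with vertex set V = Fin n and edge family (e i) indexed by I = Fin m
-- is represented by  e : Fin m → Subset n.  Subsets of the index set I are Subset m.

_∈ᵇ_ : ∀ {k} → Fin k → Subset k → Bool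
i ∈ᵇ S = lookup S i

anyᵇ : ∀ {k} → Subset k → Bool
anyᵇ [] = false
anyᵇ (b ∷ S) = b ∨ anyᵇ S

allSubsets : (k : ℕ) → List (Subset k)
allSubsets zero = [] ∷ []
allSubsets (suc k) = map (outside ∷_) (allSubsets k) ++ map (inside ∷_) (allSubsets k)

elems : ∀ {k} → Subset k → List (Fin k)
elems {k} S = filter (λ i → Data.Bool._≟_ (i ∈ᵇ S) true) (allFin k)

countᵇ : ∀ {k} → (Fin k → Bool) → ℕ
countᵇ {k} p = length (filter (λ i → Data.Bool._≟_ (p i) true) (allFin k))

module Hypergraph {n m : ℕ} (e : Fin m → Subset n) where

  -- union of the edges indexed by J (vertex set of the edge section hypergraph H × J)
  cover : Subset m → Subset n
  cover J = foldr (λ j S → e j ∪ S) ⊥ (elems J)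

  step : Subset m → Subset n → Subset n
  step J r = foldr (λ j S → if anyᵇ (e j ∩ r) then e j ∪ S else S) r (elems J)

  iter : ℕ → Subset m → Subset n → Subset n
  iter zero J r = r
  iter (suc k) J r = step J (iter k J r)

  -- the set of vertices connected to v in H_J (a path visits at most n vertices,
  -- so n closure steps suffice)
  reach : Subset m → Fin n → Subset n
  reach J v = iter n J ⁅ v ⁆

  isRep : Subset m → Fin n → Bool
  isRep J v = not (anyᵇ (Data.Vec.tabulate (λ u → (u ∈ᵇ reach J v) ∧ (toℕ u <ᵇ toℕ v))))

  -- k(H_J): number of connected components of the partial hypergraph (vertex set V)
  kPartial : Subset m → ℕ
  kPartial J = countᵇ (isRep J)

  -- k(H × J): number of connected components of the edge section hypergraph
  -- (vertex set = union of the edges in J; its components are those of H_J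
  --  containing a covered vertex)
  kSection : Subset m → ℕ
  kSection J = countᵇ (λ v → (v ∈ᵇ cover J) ∧ isRep J v)

  vertexDisjointPair : Subset m → Subset m → Bool
  vertexDisjointPair A B =
    not (anyᵇ (A ∩ B)) ∧
    not (anyᵇ (Data.Vec.tabulate (λ a → (a ∈ᵇ A) ∧ anyᵇ (Data.Vec.tabulate (λ b → (b ∈ᵇ B) ∧ anyᵇ (e a ∩ e b))))))

  isMatching : Subset m → Bool
  isMatching M =
    not (anyᵇ (Data.Vec.tabulate (λ i → (i ∈ᵇ M) ∧ anyᵇ (Data.Vec.tabulate (λ j →
      (j ∈ᵇ M) ∧ not ⌊ i ≟ j ⌋ ∧ anyᵇ (e i ∩ e j))))))

  mStar : Subset m → ℕ
  mStar M = foldr (λ i s → ∣ e i ∣ + s) 0 (elems M)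

  module Poly {c ℓ : Level} (R : CommutativeSemiring c ℓ) where
    open CommutativeSemiring R renaming (_+_ to _⊕_; _*_ to _⊛_)

    -- x ^ k with x ^ 0 = 1 (so 0 ^ 0 = 1)
    pow : Carrier → ℕ → Carrier
    pow x zero = 1#
    pow x (suc k) = x ⊛ pow x k

    Σ[_] : List Carrier → Carrier
    Σ[ xs ] = foldr _⊕_ 0# xs

    prodOver : Subset m → (Fin m → Carrier) → Carrier
    prodOver S t = foldr (λ i p → t i ⊛ p) 1# (elems S)

    -- The pair (A , B) ranges over vertex disjoint pairs; A ⊔ B is A ∪ B.
    -- (Exponents use truncated subtraction; they are nonnegative for vertex
    --  disjoint pairs when all hyperedges are nonempty.)
    ξ : Carrier → Carrier → Carrier → (Fin m → Carrier) → Carrier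
    ξ x y z t = Σ[ concatMap (λ A → concatMap (λ B →
        if vertexDisjointPair A B
        then (pow x (kPartial (A ∪ B) ∸ kSection B)
              ⊛ pow y ((∣ A ∣ + ∣ B ∣) ∸ kSection B)
              ⊛ pow z (kSection B)
              ⊛ prodOver (A ∪ B) t) ∷ []
        else []) (allSubsets m)) (allSubsets m) ]

    μ : Carrier → (Fin m → Carrier) → Carrier
    μ x y = Σ[ concatMap (λ M →
        if isMatching M then (pow x (n ∸ mStar M) ⊛ prodOver M y) ∷ [] else [])
        (allSubsets m) ]

-- With y = 0 only the pairs (A , B) with k(H × B) = |A| + |B| contribute. Each component of H × B
-- is represented by its least vertex, which is the least vertex of one of the edges of B; hence
-- k(H × B) ≤ |B|, which forces A = ∅. If two edges of B meet, the one with the larger least vertex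
-- is not needed to name a component, so k(H × B) < |B| unless B is a matching. For a matching the
-- components of H × B are its edges and the uncovered vertices are isolated in H_B, so
-- k(H_B) - k(H × B) = n - m_*(B), and z^|B| ∏_{i∈B} t_i = ∏_{i∈B} z t_i.

module Submission where

open import Defs
open import Level using (Level)
open import Function using (_∘_)
open import Data.Bool using (Bool; true; false; if_then_else_; _∧_; _∨_; not; T)
open import Data.Bool.Properties using (¬-not; not-injective)
open import Data.Unit using (tt)
open import Data.Empty using (⊥-elim)
open import Data.Product using (∃; _×_; _,_; proj₁; proj₂)
open import Data.Sum using (_⊎_; inj₁; inj₂)
open import Data.Nat using (ℕ; zero; suc; _+_; _∸_; _<ᵇ_; _≤_; _<_; z≤n; s≤s)
open import Data.Nat.Properties
  using (≤-trans; ≤-antisym; ≤-reflexive; ≤-total; ≮⇒≥; <⇒≱; <⇒<ᵇ; <ᵇ⇒<;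
         +-suc; m+n∸m≡n; m∸n+n≡m; m<n⇒0<n∸m; n∸n≡0; m≤n⇒m<n∨m≡n; ≤-<-trans; m<n+m)
open import Data.Fin as Fin using (Fin; toℕ)
open import Data.Fin.Properties using (toℕ<n; toℕ-injective) renaming (_≟_ to _≟ᶠ_)
open import Data.Fin.Subset using (Subset; inside; outside; _∪_; _∩_; ⁅_⁆; ∣_∣; ⊥; Nonempty)
open import Data.Fin.Subset.Properties using (x∈⁅x⁆; x∈⁅y⁆⇒x≡y; ∪-identityˡ; ∣⊥∣≡0)
open import Data.Vec using ([]; _∷_; lookup; tabulate)
open import Data.Vec.Properties
  using (lookup-zipWith; lookup-replicate; lookup∘tabulate; []=⇒lookup; lookup⇒[]=)
open import Data.List as List using (List; []; _∷_; map; _++_; foldr; allFin; filter; length; concatMap)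
open import Data.List.Properties using (length-map)
open import Data.List.Membership.Propositional using (_∈_)
open import Data.List.Membership.Propositional.Properties
  using (∈-filter⁺; ∈-filter⁻; ∈-allFin; ∈-map⁺; ∈-map⁻)
open import Data.List.Relation.Unary.Any using (here; there)
open import Data.List.Relation.Unary.All as All using (All; []; _∷_)
import Data.List.Relation.Unary.All.Properties as All
open import Data.List.Relation.Unary.AllPairs using ([]; _∷_)
open import Data.List.Relation.Unary.Unique.Propositional using (Unique)
open import Data.List.Relation.Unary.Unique.Propositional.Properties using (filter⁺; allFin⁺)
open import Relation.Nullary using (¬_; Dec; yes; no)
open import Relation.Nullary.Decidable using (⌊_⌋; isYes≗does; dec-true; dec-false)
open import Relation.Binary.PropositionalEquality
  using (_≡_; _≢_; refl; sym; trans; cong; cong₂; subst; module ≡-Reasoning)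
open import Algebra.Bundles using (CommutativeSemiring)
import Algebra.Properties.CommutativeSemigroup as CommutativeSemigroupProperties
import Relation.Binary.Reasoning.Setoid as SetoidReasoning

module _ {a} {A : Set a} where

  remove : ∀ {x : A} (ys : List A) → x ∈ ys → List A
  remove (_ ∷ ys) (here _)    = ys
  remove (y ∷ ys) (there x∈) = y ∷ remove ys x∈

  length-remove : ∀ {x : A} (ys : List A) (x∈ : x ∈ ys) → suc (length (remove ys x∈)) ≡ length ys
  length-remove (_ ∷ ys) (here _)    = refl
  length-remove (y ∷ ys) (there x∈) = cong suc (length-remove ys x∈)

  ∈-remove : ∀ {x y : A} (ys : List A) (x∈ : x ∈ ys) → y ∈ ys → y ≢ x → y ∈ remove ys x∈
  ∈-remove (_ ∷ ys) (here refl) (here refl) y≢x = ⊥-elim (y≢x refl)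
  ∈-remove (_ ∷ ys) (here refl) (there y∈)  _   = y∈
  ∈-remove (_ ∷ ys) (there x∈)  (here y≡)   _   = here y≡
  ∈-remove (_ ∷ ys) (there x∈)  (there y∈)  y≢x = there (∈-remove ys x∈ y∈ y≢x)

  Unique⇒length≤ : ∀ {xs ys : List A} → Unique xs → (∀ {x} → x ∈ xs → x ∈ ys) → length xs ≤ length ys
  Unique⇒length≤ {[]}     _             _  = z≤n
  Unique⇒length≤ {x ∷ xs} {ys} (x∉ ∷ u) xs⊆ys = begin
    suc (length xs)                       ≤⟨ s≤s (Unique⇒length≤ u xs⊆ys-x) ⟩
    suc (length (remove ys x∈ys))         ≡⟨ length-remove ys x∈ys ⟩
    length ys                             ∎
    where
    open Data.Nat.Properties.≤-Reasoning
    x∈ys : x ∈ ys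
    x∈ys = xs⊆ys (here refl)
    xs⊆ys-x : ∀ {y} → y ∈ xs → y ∈ remove ys x∈ys
    xs⊆ys-x y∈ = ∈-remove ys x∈ys (xs⊆ys (there y∈)) (λ y≡x → All.lookup x∉ y∈ (sym y≡x))

  map-Unique : ∀ {b} {B : Set b} (f : A → B) {xs : List A} →
    (∀ {x y} → x ∈ xs → y ∈ xs → f x ≡ f y → x ≡ y) → Unique xs → Unique (map f xs)
  map-Unique f {[]}     _   []        = []
  map-Unique f {x ∷ xs} inj (x∉ ∷ u) =
    All.map⁺ (All.tabulate (λ y∈ fx≡fy → All.lookup x∉ y∈ (inj (here refl) (there y∈) fx≡fy)))
    ∷ map-Unique f (λ x∈ y∈ → inj (there x∈) (there y∈)) u

false≢true : false ≢ true
false≢true ()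

⌊≟ᶠ⌋≡true : ∀ {k} {i j : Fin k} → i ≡ j → ⌊ i ≟ᶠ j ⌋ ≡ true
⌊≟ᶠ⌋≡true {i = i} {j} i≡j = trans (isYes≗does (i ≟ᶠ j)) (dec-true (i ≟ᶠ j) i≡j)

⌊≟ᶠ⌋≡false : ∀ {k} {i j : Fin k} → i ≢ j → ⌊ i ≟ᶠ j ⌋ ≡ false
⌊≟ᶠ⌋≡false {i = i} {j} i≢j = trans (isYes≗does (i ≟ᶠ j)) (dec-false (i ≟ᶠ j) i≢j)

∧-true⁻ : ∀ {a b} → a ∧ b ≡ true → a ≡ true × b ≡ true
∧-true⁻ {true} {true} _ = refl , refl

∈ᵇ-∪ : ∀ {k} (p q : Subset k) i → i ∈ᵇ (p ∪ q) ≡ (i ∈ᵇ p ∨ i ∈ᵇ q)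
∈ᵇ-∪ p q i = lookup-zipWith _∨_ i p q

∈ᵇ-∩ : ∀ {k} (p q : Subset k) i → i ∈ᵇ (p ∩ q) ≡ (i ∈ᵇ p ∧ i ∈ᵇ q)
∈ᵇ-∩ p q i = lookup-zipWith _∧_ i p q

∉ᵇ⊥ : ∀ {k} (i : Fin k) → i ∈ᵇ ⊥ ≡ false
∉ᵇ⊥ i = lookup-replicate i false

∈ᵇ⁅x⁆ : ∀ {k} (x : Fin k) → x ∈ᵇ ⁅ x ⁆ ≡ true
∈ᵇ⁅x⁆ x = []=⇒lookup (x∈⁅x⁆ x)

∈ᵇ⁅y⁆⇒≡ : ∀ {k} {x y : Fin k} → x ∈ᵇ ⁅ y ⁆ ≡ true → x ≡ y
∈ᵇ⁅y⁆⇒≡ {x = x} {y} x∈ = x∈⁅y⁆⇒x≡y y (lookup⇒[]= x ⁅ y ⁆ x∈)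

∈ᵇ-∪⁺ˡ : ∀ {k} (p q : Subset k) {i} → i ∈ᵇ p ≡ true → i ∈ᵇ (p ∪ q) ≡ true
∈ᵇ-∪⁺ˡ p q {i} i∈p rewrite ∈ᵇ-∪ p q i | i∈p = refl

∈ᵇ-∪⁺ʳ : ∀ {k} (p q : Subset k) {i} → i ∈ᵇ q ≡ true → i ∈ᵇ (p ∪ q) ≡ true
∈ᵇ-∪⁺ʳ p q {i} i∈q rewrite ∈ᵇ-∪ p q i | i∈q with i ∈ᵇ p
... | true  = refl
... | false = refl

∈ᵇ-∪⁻ : ∀ {k} (p q : Subset k) {i} → i ∈ᵇ (p ∪ q) ≡ true → i ∈ᵇ p ≡ true ⊎ i ∈ᵇ q ≡ true
∈ᵇ-∪⁻ p q {i} i∈ rewrite ∈ᵇ-∪ p q i with i ∈ᵇ p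
... | true  = inj₁ refl
... | false = inj₂ i∈

anyᵇ⁺ : ∀ {k} (S : Subset k) {i} → i ∈ᵇ S ≡ true → anyᵇ S ≡ true
anyᵇ⁺ (true  ∷ S) _                 = refl
anyᵇ⁺ (false ∷ S) {Fin.suc i} i∈S = anyᵇ⁺ S i∈S

anyᵇ⁻ : ∀ {k} (S : Subset k) → anyᵇ S ≡ true → ∃ λ i → i ∈ᵇ S ≡ true
anyᵇ⁻ (true  ∷ S) _ = Fin.zero , refl
anyᵇ⁻ (false ∷ S) any with anyᵇ⁻ S any
... | i , i∈S = Fin.suc i , i∈S

¬anyᵇ⁺ : ∀ {k} (S : Subset k) → (∀ i → i ∈ᵇ S ≡ false) → anyᵇ S ≡ false
¬anyᵇ⁺ []      _    = refl
¬anyᵇ⁺ (b ∷ S) none rewrite none Fin.zero = ¬anyᵇ⁺ S (none ∘ Fin.suc)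

¬anyᵇ⁻ : ∀ {k} (S : Subset k) → anyᵇ S ≡ false → ∀ i → i ∈ᵇ S ≡ false
¬anyᵇ⁻ (false ∷ S) _    Fin.zero    = refl
¬anyᵇ⁻ (false ∷ S) none (Fin.suc i) = ¬anyᵇ⁻ S none i

meets⁺ : ∀ {k} (p q : Subset k) {i} → i ∈ᵇ p ≡ true → i ∈ᵇ q ≡ true → anyᵇ (p ∩ q) ≡ true
meets⁺ p q {i} i∈p i∈q = anyᵇ⁺ (p ∩ q) (trans (∈ᵇ-∩ p q i) (cong₂ _∧_ i∈p i∈q))

meets⁻ : ∀ {k} (p q : Subset k) → anyᵇ (p ∩ q) ≡ true → ∃ λ i → i ∈ᵇ p ≡ true × i ∈ᵇ q ≡ true
meets⁻ p q meet with anyᵇ⁻ (p ∩ q) meet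
... | i , i∈ = i , ∧-true⁻ (trans (sym (∈ᵇ-∩ p q i)) i∈)

_⊆ᵇ_ : ∀ {k} → Subset k → Subset k → Set
p ⊆ᵇ q = ∀ {i} → i ∈ᵇ p ≡ true → i ∈ᵇ q ≡ true

meets-mono : ∀ {k} (p : Subset k) {q r} → q ⊆ᵇ r → anyᵇ (p ∩ q) ≡ true → anyᵇ (p ∩ r) ≡ true
meets-mono p {q} {r} q⊆r meet with meets⁻ p q meet
... | i , i∈p , i∈q = meets⁺ p r i∈p (q⊆r i∈q)

∈ᵇ-elems⁺ : ∀ {k} (S : Subset k) {i} → i ∈ᵇ S ≡ true → i ∈ elems S
∈ᵇ-elems⁺ S {i} i∈S = ∈-filter⁺ (λ j → Data.Bool._≟_ (j ∈ᵇ S) true) (∈-allFin i) i∈S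

∈ᵇ-elems⁻ : ∀ {k} (S : Subset k) {i} → i ∈ elems S → i ∈ᵇ S ≡ true
∈ᵇ-elems⁻ {k} S i∈ = proj₂ (∈-filter⁻ (λ j → Data.Bool._≟_ (j ∈ᵇ S) true) {xs = allFin k} i∈)

elems-Unique : ∀ {k} (S : Subset k) → Unique (elems S)
elems-Unique {k} S = filter⁺ (λ j → Data.Bool._≟_ (j ∈ᵇ S) true) (allFin⁺ k)

count : ∀ {k} → (Fin k → Bool) → ℕ
count {zero}  p = 0
count {suc k} p = (if p Fin.zero then 1 else 0) + count (p ∘ Fin.suc)

count-tabulate : ∀ {a} {A : Set a} {k} (f : Fin k → A) (q : A → Bool) →
  length (filter (λ x → Data.Bool._≟_ (q x) true) (List.tabulate f)) ≡ count (q ∘ f)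
count-tabulate {k = zero}  f q = refl
count-tabulate {k = suc k} f q with q (f Fin.zero)
... | true  = cong suc (count-tabulate (f ∘ Fin.suc) q)
... | false = count-tabulate (f ∘ Fin.suc) q

countᵇ≡count : ∀ {k} (p : Fin k → Bool) → countᵇ p ≡ count p
countᵇ≡count p = count-tabulate (λ i → i) p

∣S∣≡count : ∀ {k} (S : Subset k) → ∣ S ∣ ≡ count (_∈ᵇ S)
∣S∣≡count []          = refl
∣S∣≡count (true  ∷ S) = cong suc (∣S∣≡count S)
∣S∣≡count (false ∷ S) = ∣S∣≡count S

length-elems : ∀ {k} (S : Subset k) → length (elems S) ≡ ∣ S ∣
length-elems S = trans (count-tabulate (λ i → i) (_∈ᵇ S)) (sym (∣S∣≡count S))

count-cong : ∀ {k} {p q : Fin k → Bool} → (∀ i → p i ≡ q i) → count p ≡ count q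
count-cong {zero}  _   = refl
count-cong {suc k} p≡q =
  cong₂ _+_ (cong (λ b → if b then 1 else 0) (p≡q Fin.zero)) (count-cong (p≡q ∘ Fin.suc))

count-split : ∀ {k} (c p : Fin k → Bool) →
  count p ≡ count (λ i → c i ∧ p i) + count (λ i → not (c i) ∧ p i)
count-split {zero}  c p = refl
count-split {suc k} c p with c Fin.zero | p Fin.zero | count-split (c ∘ Fin.suc) (p ∘ Fin.suc)
... | true  | true  | split = cong suc split
... | true  | false | split = split
... | false | true  | split = trans (cong suc split) (sym (+-suc _ _))
... | false | false | split = split

count+count-not : ∀ {k} (c : Fin k → Bool) → count c + count (not ∘ c) ≡ k
count+count-not {zero}  c = refl
count+count-not {suc k} c with c Fin.zero | count+count-not (c ∘ Fin.suc)
... | true  | sum = cong suc sum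
... | false | sum = trans (+-suc _ _) (cong suc sum)

∣p∪q∣≡∣p∣+∣q∣ : ∀ {k} (p q : Subset k) → (∀ {i} → i ∈ᵇ p ≡ true → i ∈ᵇ q ≡ false) →
  ∣ p ∪ q ∣ ≡ ∣ p ∣ + ∣ q ∣
∣p∪q∣≡∣p∣+∣q∣ []          []          _    = refl
∣p∪q∣≡∣p∣+∣q∣ (true  ∷ p) (true  ∷ q) disj with () ← disj {Fin.zero} refl
∣p∪q∣≡∣p∣+∣q∣ (true  ∷ p) (false ∷ q) disj = cong suc (∣p∪q∣≡∣p∣+∣q∣ p q (λ {i} → disj {Fin.suc i}))
∣p∪q∣≡∣p∣+∣q∣ (false ∷ p) (true  ∷ q) disj =
  trans (cong suc (∣p∪q∣≡∣p∣+∣q∣ p q (λ {i} → disj {Fin.suc i}))) (sym (+-suc _ _))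
∣p∪q∣≡∣p∣+∣q∣ (false ∷ p) (false ∷ q) disj = ∣p∪q∣≡∣p∣+∣q∣ p q (λ {i} → disj {Fin.suc i})

module _ {k} (p : Fin k → Bool) where

  private
    p? : ∀ i → Dec (p i ≡ true)
    p? i = Data.Bool._≟_ (p i) true

  countᵇ≤length : ∀ {zs} → (∀ {v} → p v ≡ true → v ∈ zs) → countᵇ p ≤ length zs
  countᵇ≤length p⊆zs =
    Unique⇒length≤ (filter⁺ p? (allFin⁺ k)) (p⊆zs ∘ proj₂ ∘ ∈-filter⁻ p? {xs = allFin k})

  length≤countᵇ : ∀ {zs} → Unique zs → (∀ {v} → v ∈ zs → p v ≡ true) → length zs ≤ countᵇ p
  length≤countᵇ u zs⊆p = Unique⇒length≤ u (λ {v} v∈ → ∈-filter⁺ p? (∈-allFin v) (zs⊆p v∈))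

∃-least-element : ∀ {k} (S : Subset k) {v} → v ∈ᵇ S ≡ true →
  ∃ λ u → u ∈ᵇ S ≡ true × (∀ {w} → w ∈ᵇ S ≡ true → toℕ u ≤ toℕ w)
∃-least-element (true  ∷ S) _ = Fin.zero , refl , λ _ → z≤n
∃-least-element (false ∷ S) {Fin.suc v} v∈S with ∃-least-element S v∈S
... | u , u∈S , least = Fin.suc u , u∈S , λ { {Fin.suc w} w∈S → s≤s (least w∈S) }

module _ {n m : ℕ} (e : Fin m → Subset n) where
  open Hypergraph e

  ClosedUnder : Subset m → Subset n → Set
  ClosedUnder J S = ∀ {j} → j ∈ᵇ J ≡ true → anyᵇ (e j ∩ S) ≡ true → e j ⊆ᵇ S

  private
    stepList : List (Fin m) → Subset n → Subset n
    stepList js r = foldr (λ j S → if anyᵇ (e j ∩ r) then e j ∪ S else S) r js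

    smallerInComponent : Subset m → Fin n → Fin n → Bool
    smallerInComponent J v u = (u ∈ᵇ reach J v) ∧ (toℕ u <ᵇ toℕ v)

  step-⊇ : ∀ J r → r ⊆ᵇ step J r
  step-⊇ J r = go (elems J)
    where
    go : ∀ js → r ⊆ᵇ stepList js r
    go []       i∈r = i∈r
    go (j ∷ js) i∈r with anyᵇ (e j ∩ r)
    ... | true  = ∈ᵇ-∪⁺ʳ (e j) _ (go js i∈r)
    ... | false = go js i∈r

  step-edge : ∀ J r {j} → j ∈ᵇ J ≡ true → anyᵇ (e j ∩ r) ≡ true → e j ⊆ᵇ step J r
  step-edge J r {j} j∈J meet = go (elems J) (∈ᵇ-elems⁺ J j∈J)
    where
    go : ∀ js → j ∈ js → e j ⊆ᵇ stepList js r
    go (_ ∷ js) (here refl) i∈ej rewrite meet = ∈ᵇ-∪⁺ˡ (e j) _ i∈ej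
    go (k ∷ js) (there j∈)  i∈ej with anyᵇ (e k ∩ r)
    ... | true  = ∈ᵇ-∪⁺ʳ (e k) _ (go js j∈ i∈ej)
    ... | false = go js j∈ i∈ej

  step-least : ∀ J {r S} → r ⊆ᵇ S → ClosedUnder J S → step J r ⊆ᵇ S
  step-least J {r} {S} r⊆S closed = go (elems J) (∈ᵇ-elems⁻ J)
    where
    go : ∀ js → (∀ {j} → j ∈ js → j ∈ᵇ J ≡ true) → stepList js r ⊆ᵇ S
    go []       _     i∈ = r⊆S i∈
    go (j ∷ js) js⊆J i∈ with anyᵇ (e j ∩ r) in meet
    ... | false = go js (js⊆J ∘ there) i∈
    ... | true with ∈ᵇ-∪⁻ (e j) _ i∈
    ...   | inj₁ i∈ej   = closed (js⊆J (here refl)) (meets-mono (e j) r⊆S meet) i∈ej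
    ...   | inj₂ i∈rest = go js (js⊆J ∘ there) i∈rest

  iter-⊆-+ : ∀ J r k d → iter k J r ⊆ᵇ iter (d + k) J r
  iter-⊆-+ J r k zero    i∈ = i∈
  iter-⊆-+ J r k (suc d) i∈ = step-⊇ J (iter (d + k) J r) (iter-⊆-+ J r k d i∈)

  iter-mono : ∀ J r {k l} → k ≤ l → iter k J r ⊆ᵇ iter l J r
  iter-mono J r {k} {l} k≤l =
    subst (λ l → iter k J r ⊆ᵇ iter l J r) (m∸n+n≡m k≤l) (iter-⊆-+ J r k (l ∸ k))

  iter-least : ∀ J {r S} k → r ⊆ᵇ S → ClosedUnder J S → iter k J r ⊆ᵇ S
  iter-least J zero    r⊆S _      = r⊆S
  iter-least J (suc k) r⊆S closed = step-least J (iter-least J k r⊆S closed) closed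

  reach-least : ∀ J {v S} → v ∈ᵇ S ≡ true → ClosedUnder J S → reach J v ⊆ᵇ S
  reach-least J {v} {S} v∈S =
    iter-least J n (λ u∈ → subst (λ u → u ∈ᵇ S ≡ true) (sym (∈ᵇ⁅y⁆⇒≡ u∈)) v∈S)

  edge⊆reach : ∀ J {j v} → j ∈ᵇ J ≡ true → v ∈ᵇ e j ≡ true → e j ⊆ᵇ reach J v
  edge⊆reach J {j} {v} j∈J v∈ej i∈ej =
    iter-mono J ⁅ v ⁆ (≤-trans (s≤s z≤n) (toℕ<n v))
      (step-edge J ⁅ v ⁆ j∈J (meets⁺ (e j) ⁅ v ⁆ v∈ej (∈ᵇ⁅x⁆ v)) i∈ej)

  -- reach J v performs n closure steps; reaching an edge adjacent to an edge through v takes two.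
  adjacent-edge⊆reach : ∀ J {i j v w} → 2 ≤ n → i ∈ᵇ J ≡ true → j ∈ᵇ J ≡ true →
    v ∈ᵇ e j ≡ true → w ∈ᵇ e j ≡ true → w ∈ᵇ e i ≡ true → e i ⊆ᵇ reach J v
  adjacent-edge⊆reach J {i} {j} {v} {w} 2≤n i∈J j∈J v∈ej w∈ej w∈ei u∈ei =
    iter-mono J ⁅ v ⁆ 2≤n (step-edge J _ i∈J (meets⁺ (e i) _ w∈ei w∈iter₁) u∈ei)
    where
    w∈iter₁ : w ∈ᵇ iter 1 J ⁅ v ⁆ ≡ true
    w∈iter₁ = step-edge J ⁅ v ⁆ j∈J (meets⁺ (e j) ⁅ v ⁆ v∈ej (∈ᵇ⁅x⁆ v)) w∈ej

  isRep⇒minimal : ∀ {J v u} → isRep J v ≡ true → u ∈ᵇ reach J v ≡ true → toℕ v ≤ toℕ u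
  isRep⇒minimal {J} {v} {u} rep u∈ = ≮⇒≥ u≮v
    where
    entry : ((u ∈ᵇ reach J v) ∧ (toℕ u <ᵇ toℕ v)) ≡ false
    entry = trans (sym (lookup∘tabulate (smallerInComponent J v) u))
                  (¬anyᵇ⁻ (tabulate (smallerInComponent J v)) (not-injective rep) u)
    u≮v : ¬ toℕ u < toℕ v
    u≮v u<v = subst T (trans (cong (_∧ (toℕ u <ᵇ toℕ v)) (sym u∈)) entry) (<⇒<ᵇ u<v)

  minimal⇒isRep : ∀ {J v} → (∀ {u} → u ∈ᵇ reach J v ≡ true → toℕ v ≤ toℕ u) → isRep J v ≡ true
  minimal⇒isRep {J} {v} minimal = cong not (¬anyᵇ⁺ (tabulate (smallerInComponent J v)) entry)
    where
    entry : ∀ u → lookup (tabulate (smallerInComponent J v)) u ≡ false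
    entry u rewrite lookup∘tabulate (smallerInComponent J v) u with u ∈ᵇ reach J v in u∈
    ... | false = refl
    ... | true with toℕ u <ᵇ toℕ v | <ᵇ⇒< (toℕ u) (toℕ v)
    ...   | false | _   = refl
    ...   | true  | u<v = ⊥-elim (<⇒≱ (u<v tt) (minimal u∈))

  record Overlap (M : Subset m) : Set where
    constructor mkOverlap
    field
      {i j} : Fin m
      {w}   : Fin n
      i∈M : i ∈ᵇ M ≡ true
      j∈M : j ∈ᵇ M ≡ true
      i≢j : i ≢ j
      w∈ei : w ∈ᵇ e i ≡ true
      w∈ej : w ∈ᵇ e j ≡ true

  Overlap-sym : ∀ {M} → Overlap M → Overlap M
  Overlap-sym (mkOverlap i∈M j∈M i≢j w∈ei w∈ej) = mkOverlap j∈M i∈M (i≢j ∘ sym) w∈ej w∈ei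

  private
    overlapsWith : Subset m → Fin m → Fin m → Bool
    overlapsWith M i j = (j ∈ᵇ M) ∧ not ⌊ i ≟ᶠ j ⌋ ∧ anyᵇ (e i ∩ e j)

    overlapping : Subset m → Fin m → Bool
    overlapping M i = (i ∈ᵇ M) ∧ anyᵇ (tabulate (overlapsWith M i))

  isMatching⇒¬Overlap : ∀ M → isMatching M ≡ true → ¬ Overlap M
  isMatching⇒¬Overlap M matching (mkOverlap {i} {j} i∈M j∈M i≢j w∈ei w∈ej) =
    false≢true (trans (sym i-free) (cong₂ _∧_ i∈M (anyᵇ⁺ (tabulate (overlapsWith M i)) j-witness)))
    where
    i-free : overlapping M i ≡ false
    i-free = trans (sym (lookup∘tabulate (overlapping M) i))
                   (¬anyᵇ⁻ (tabulate (overlapping M)) (not-injective matching) i)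
    j-witness : lookup (tabulate (overlapsWith M i)) j ≡ true
    j-witness = trans (lookup∘tabulate (overlapsWith M i) j)
      (cong₂ _∧_ j∈M (cong₂ _∧_ (cong not (⌊≟ᶠ⌋≡false i≢j)) (meets⁺ (e i) (e j) w∈ei w∈ej)))

  ¬isMatching⇒Overlap : ∀ M → isMatching M ≡ false → Overlap M
  ¬isMatching⇒Overlap M ¬matching
    with anyᵇ⁻ (tabulate (overlapping M)) (not-injective ¬matching)
  ... | i , i-overlaps
    with ∧-true⁻ (trans (sym (lookup∘tabulate (overlapping M) i)) i-overlaps)
  ... | i∈M , any-j
    with anyᵇ⁻ (tabulate (overlapsWith M i)) any-j
  ... | j , j-overlaps
    with ∧-true⁻ (trans (sym (lookup∘tabulate (overlapsWith M i) j)) j-overlaps)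
  ... | j∈M , distinct-meet
    with ∧-true⁻ distinct-meet
  ... | i≠j , meet
    with meets⁻ (e i) (e j) meet
  ... | w , w∈ei , w∈ej = mkOverlap i∈M j∈M i≢j w∈ei w∈ej
    where
    i≢j : i ≢ j
    i≢j i≡j = false≢true (trans (sym (cong not (⌊≟ᶠ⌋≡true i≡j))) i≠j)

  vertexDisjointPair-⊥ˡ : ∀ B → vertexDisjointPair ⊥ B ≡ true
  vertexDisjointPair-⊥ˡ B = cong₂ (λ p q → not p ∧ not q)
    (¬anyᵇ⁺ (⊥ ∩ B) (λ i → trans (∈ᵇ-∩ ⊥ B i) (cong (_∧ (i ∈ᵇ B)) (∉ᵇ⊥ i))))
    (¬anyᵇ⁺ (tabulate adjacentToB) λ a →
      trans (lookup∘tabulate adjacentToB a) (cong (_∧ meetsB a) (∉ᵇ⊥ a)))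
    where
    meetsB : Fin m → Bool
    meetsB a = anyᵇ (tabulate (λ b → (b ∈ᵇ B) ∧ anyᵇ (e a ∩ e b)))
    adjacentToB : Fin m → Bool
    adjacentToB a = (a ∈ᵇ ⊥) ∧ meetsB a

  ⋃edges : List (Fin m) → Subset n
  ⋃edges = foldr (λ j S → e j ∪ S) ⊥

  ∈-⋃edges⁺ : ∀ {js j v} → j ∈ js → v ∈ᵇ e j ≡ true → v ∈ᵇ ⋃edges js ≡ true
  ∈-⋃edges⁺ {j ∷ _}  (here refl) v∈ej = ∈ᵇ-∪⁺ˡ (e j) _ v∈ej
  ∈-⋃edges⁺ {k ∷ _}  (there j∈)  v∈ej = ∈ᵇ-∪⁺ʳ (e k) _ (∈-⋃edges⁺ j∈ v∈ej)

  ∈-⋃edges⁻ : ∀ js {v} → v ∈ᵇ ⋃edges js ≡ true → ∃ λ j → j ∈ js × v ∈ᵇ e j ≡ true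
  ∈-⋃edges⁻ []       {v} v∈ with () ← trans (sym v∈) (∉ᵇ⊥ v)
  ∈-⋃edges⁻ (k ∷ js)     v∈ with ∈ᵇ-∪⁻ (e k) _ v∈
  ... | inj₁ v∈ek = k , here refl , v∈ek
  ... | inj₂ v∈rest with ∈-⋃edges⁻ js v∈rest
  ...   | j , j∈ , v∈ej = j , there j∈ , v∈ej

  cover⁺ : ∀ J {j v} → j ∈ᵇ J ≡ true → v ∈ᵇ e j ≡ true → v ∈ᵇ cover J ≡ true
  cover⁺ J j∈J = ∈-⋃edges⁺ (∈ᵇ-elems⁺ J j∈J)

  cover⁻ : ∀ J {v} → v ∈ᵇ cover J ≡ true → ∃ λ j → j ∈ᵇ J ≡ true × v ∈ᵇ e j ≡ true
  cover⁻ J v∈ with ∈-⋃edges⁻ (elems J) v∈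
  ... | j , j∈ , v∈ej = j , ∈ᵇ-elems⁻ J j∈ , v∈ej

  uncovered⇒isRep : ∀ J {v} → v ∈ᵇ cover J ≡ false → isRep J v ≡ true
  uncovered⇒isRep J {v} uncovered =
    minimal⇒isRep (λ u∈ → ≤-reflexive (cong toℕ (sym (∈ᵇ⁅y⁆⇒≡ (reach-least J (∈ᵇ⁅x⁆ v) closed u∈)))))
    where
    closed : ClosedUnder J ⁅ v ⁆
    closed {j} j∈J meet with meets⁻ (e j) ⁅ v ⁆ meet
    ... | w , w∈ej , w∈⁅v⁆ with refl ← ∈ᵇ⁅y⁆⇒≡ {x = w} {y = v} w∈⁅v⁆ =
      ⊥-elim (false≢true (trans (sym uncovered) (cover⁺ J j∈J w∈ej)))

  matching-reach⊆edge : ∀ M {k v} → isMatching M ≡ true → k ∈ᵇ M ≡ true → v ∈ᵇ e k ≡ true →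
    reach M v ⊆ᵇ e k
  matching-reach⊆edge M {k} matching k∈M v∈ek = reach-least M v∈ek closed
    where
    closed : ClosedUnder M (e k)
    closed {j} j∈M meet with j ≟ᶠ k
    ... | yes refl = λ u∈ → u∈
    ... | no j≢k with meets⁻ (e j) (e k) meet
    ...   | w , w∈ej , w∈ek = ⊥-elim (isMatching⇒¬Overlap M matching (mkOverlap j∈M k∈M j≢k w∈ej w∈ek))

  ∣cover∣≡mStar : ∀ M → isMatching M ≡ true → ∣ cover M ∣ ≡ mStar M
  ∣cover∣≡mStar M matching = go (elems M) (elems-Unique M) (∈ᵇ-elems⁻ M)
    where
    go : ∀ js → Unique js → (∀ {j} → j ∈ js → j ∈ᵇ M ≡ true) →
      ∣ ⋃edges js ∣ ≡ foldr (λ i s → ∣ e i ∣ + s) 0 js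
    go []       _          _     = ∣⊥∣≡0 n
    go (j ∷ js) (j∉ ∷ u) js⊆M =
      trans (∣p∪q∣≡∣p∣+∣q∣ (e j) (⋃edges js) disjoint) (cong (∣ e j ∣ +_) (go js u (js⊆M ∘ there)))
      where
      disjoint : ∀ {v} → v ∈ᵇ e j ≡ true → v ∈ᵇ ⋃edges js ≡ false
      disjoint v∈ej = ¬-not λ v∈rest →
        let (k , k∈ , v∈ek) = ∈-⋃edges⁻ js v∈rest in
        isMatching⇒¬Overlap M matching
          (mkOverlap (js⊆M (here refl)) (js⊆M (there k∈)) (All.lookup j∉ k∈) v∈ej v∈ek)

  isSectionRep : Subset m → Fin n → Bool
  isSectionRep J v = (v ∈ᵇ cover J) ∧ isRep J v

  kPartial≡kSection+uncovered : ∀ J → kPartial J ≡ kSection J + (n ∸ ∣ cover J ∣)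
  kPartial≡kSection+uncovered J = begin
    kPartial J
      ≡⟨ countᵇ≡count (isRep J) ⟩
    count (isRep J)
      ≡⟨ count-split covered (isRep J) ⟩
    count (isSectionRep J) + count (λ v → not (covered v) ∧ isRep J v)
      ≡⟨ cong₂ _+_ (sym (countᵇ≡count (isSectionRep J))) (count-cong uncovered-rep) ⟩
    kSection J + count (not ∘ covered)
      ≡⟨ cong (kSection J +_) count-uncovered ⟩
    kSection J + (n ∸ ∣ cover J ∣)
      ∎
    where
    open ≡-Reasoning
    covered : Fin n → Bool
    covered v = v ∈ᵇ cover J
    uncovered-rep : ∀ v → (not (covered v) ∧ isRep J v) ≡ not (covered v)
    uncovered-rep v with covered v in v∉
    ... | true  = refl
    ... | false = uncovered⇒isRep J v∉
    count-uncovered : count (not ∘ covered) ≡ n ∸ ∣ cover J ∣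
    count-uncovered = begin
      count (not ∘ covered)
        ≡⟨ sym (m+n∸m≡n (count covered) _) ⟩
      count covered + count (not ∘ covered) ∸ count covered
        ≡⟨ cong₂ _∸_ (count+count-not covered) (sym (∣S∣≡count (cover J))) ⟩
      n ∸ ∣ cover J ∣
        ∎

  kPartial∸kSection≡n∸mStar : ∀ M → isMatching M ≡ true → kPartial M ∸ kSection M ≡ n ∸ mStar M
  kPartial∸kSection≡n∸mStar M matching = begin
    kPartial M ∸ kSection M                      ≡⟨ cong (_∸ kSection M) (kPartial≡kSection+uncovered M) ⟩
    kSection M + (n ∸ ∣ cover M ∣) ∸ kSection M  ≡⟨ m+n∸m≡n (kSection M) _ ⟩
    n ∸ ∣ cover M ∣                              ≡⟨ cong (n ∸_) (∣cover∣≡mStar M matching) ⟩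
    n ∸ mStar M                                  ∎
    where open ≡-Reasoning

  module _ (nonempty : ∀ j → Nonempty (e j)) where

    private
      least-of : ∀ j → ∃ λ u → u ∈ᵇ e j ≡ true × (∀ {w} → w ∈ᵇ e j ≡ true → toℕ u ≤ toℕ w)
      least-of j = ∃-least-element (e j) ([]=⇒lookup (proj₂ (nonempty j)))

    minVertex : Fin m → Fin n
    minVertex j = proj₁ (least-of j)

    minVertex∈ : ∀ j → minVertex j ∈ᵇ e j ≡ true
    minVertex∈ j = proj₁ (proj₂ (least-of j))

    minVertex-least : ∀ j {v} → v ∈ᵇ e j ≡ true → toℕ (minVertex j) ≤ toℕ v
    minVertex-least j = proj₂ (proj₂ (least-of j))

    sectionRep⇒minVertex : ∀ J {v} → isSectionRep J v ≡ true → ∃ λ k → k ∈ᵇ J ≡ true × v ≡ minVertex k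
    sectionRep⇒minVertex J {v} sectionRep with ∧-true⁻ sectionRep
    ... | v∈cover , rep with cover⁻ J v∈cover
    ...   | k , k∈J , v∈ek = k , k∈J , toℕ-injective (≤-antisym
            (isRep⇒minimal rep (edge⊆reach J k∈J v∈ek (minVertex∈ k))) (minVertex-least k v∈ek))

    kSection≤length : ∀ J {ks} → (∀ {v} → isSectionRep J v ≡ true → ∃ λ k → k ∈ ks × v ≡ minVertex k) →
      kSection J ≤ length ks
    kSection≤length J {ks} reps =
      ≤-trans (countᵇ≤length (isSectionRep J) rep∈) (≤-reflexive (length-map minVertex ks))
      where
      rep∈ : ∀ {v} → isSectionRep J v ≡ true → v ∈ map minVertex ks
      rep∈ sectionRep with reps sectionRep
      ... | k , k∈ , refl = ∈-map⁺ minVertex k∈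

    kSection≤∣J∣ : ∀ J → kSection J ≤ ∣ J ∣
    kSection≤∣J∣ J = subst (kSection J ≤_) (length-elems J) (kSection≤length J reps)
      where
      reps : ∀ {v} → isSectionRep J v ≡ true → ∃ λ k → k ∈ elems J × v ≡ minVertex k
      reps sectionRep with sectionRep⇒minVertex J sectionRep
      ... | k , k∈J , v≡ = k , ∈ᵇ-elems⁺ J k∈J , v≡

    -- If the least vertex of j represents a component, so does that of i, which lies in the same
    -- component and is not larger; so the two least vertices coincide.
    Overlap⇒sectionRep-avoids : ∀ {M} (o : Overlap M) →
      toℕ (minVertex (Overlap.i o)) ≤ toℕ (minVertex (Overlap.j o)) →
      ∀ {v} → isSectionRep M v ≡ true → ∃ λ k → k ∈ᵇ M ≡ true × k ≢ Overlap.j o × v ≡ minVertex k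
    Overlap⇒sectionRep-avoids {M} (mkOverlap {i} {j} i∈M j∈M i≢j w∈ei w∈ej) mi≤mj sectionRep
      with sectionRep⇒minVertex M sectionRep
    ... | k , k∈M , refl with k ≟ᶠ j
    ...   | no k≢j   = k , k∈M , k≢j , refl
    ...   | yes refl with m≤n⇒m<n∨m≡n mi≤mj
    ...     | inj₂ mi≡mj = i , i∈M , i≢j , toℕ-injective (sym mi≡mj)
    ...     | inj₁ mi<mj = ⊥-elim (<⇒≱ mi<mj (isRep⇒minimal (proj₂ (∧-true⁻ sectionRep))
              (adjacent-edge⊆reach M 2≤n i∈M j∈M (minVertex∈ j) w∈ej w∈ei (minVertex∈ i))))
      where
      2≤n : 2 ≤ n
      2≤n = ≤-trans (s≤s (≤-trans (s≤s z≤n) mi<mj)) (toℕ<n (minVertex j))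

    Overlap⇒kSection<∣M∣ : ∀ {M} (o : Overlap M) →
      toℕ (minVertex (Overlap.i o)) ≤ toℕ (minVertex (Overlap.j o)) → kSection M < ∣ M ∣
    Overlap⇒kSection<∣M∣ {M} o mi≤mj = begin
      suc (kSection M)                   ≤⟨ s≤s (kSection≤length M reps) ⟩
      suc (length (remove (elems M) j∈)) ≡⟨ length-remove (elems M) j∈ ⟩
      length (elems M)                   ≡⟨ length-elems M ⟩
      ∣ M ∣                              ∎
      where
      open Data.Nat.Properties.≤-Reasoning
      j∈ : Overlap.j o ∈ elems M
      j∈ = ∈ᵇ-elems⁺ M (Overlap.j∈M o)
      reps : ∀ {v} → isSectionRep M v ≡ true → ∃ λ k → k ∈ remove (elems M) j∈ × v ≡ minVertex k
      reps sectionRep with Overlap⇒sectionRep-avoids o mi≤mj sectionRep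
      ... | k , k∈M , k≢j , v≡ = k , ∈-remove (elems M) j∈ (∈ᵇ-elems⁺ M k∈M) k≢j , v≡

    kSection<∣M∣ : ∀ M → isMatching M ≡ false → kSection M < ∣ M ∣
    kSection<∣M∣ M ¬matching with ¬isMatching⇒Overlap M ¬matching
    ... | o with ≤-total (toℕ (minVertex (Overlap.i o))) (toℕ (minVertex (Overlap.j o)))
    ...   | inj₁ mi≤mj = Overlap⇒kSection<∣M∣ o mi≤mj
    ...   | inj₂ mj≤mi = Overlap⇒kSection<∣M∣ (Overlap-sym o) mj≤mi

    kSection≡∣M∣ : ∀ M → isMatching M ≡ true → kSection M ≡ ∣ M ∣
    kSection≡∣M∣ M matching = ≤-antisym (kSection≤∣J∣ M) (begin
      ∣ M ∣                            ≡⟨ sym (length-elems M) ⟩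
      length (elems M)                 ≡⟨ sym (length-map minVertex (elems M)) ⟩
      length (map minVertex (elems M)) ≤⟨ length≤countᵇ (isSectionRep M) unique rep ⟩
      kSection M                       ∎)
      where
      open Data.Nat.Properties.≤-Reasoning
      injective : ∀ {a b} → a ∈ elems M → b ∈ elems M → minVertex a ≡ minVertex b → a ≡ b
      injective {a} {b} a∈ b∈ ma≡mb with a ≟ᶠ b
      ... | yes a≡b = a≡b
      ... | no  a≢b = ⊥-elim (isMatching⇒¬Overlap M matching
              (mkOverlap (∈ᵇ-elems⁻ M a∈) (∈ᵇ-elems⁻ M b∈) a≢b
                 (minVertex∈ a) (subst (λ u → u ∈ᵇ e b ≡ true) (sym ma≡mb) (minVertex∈ b))))
      unique : Unique (map minVertex (elems M))
      unique = map-Unique minVertex injective (elems-Unique M)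
      rep : ∀ {v} → v ∈ map minVertex (elems M) → isSectionRep M v ≡ true
      rep v∈ with ∈-map⁻ minVertex v∈
      ... | k , k∈ , refl = cong₂ _∧_ (cover⁺ M k∈M (minVertex∈ k))
              (minimal⇒isRep λ u∈ →
                 minVertex-least k (matching-reach⊆edge M matching k∈M (minVertex∈ k) u∈))
        where
        k∈M : k ∈ᵇ M ≡ true
        k∈M = ∈ᵇ-elems⁻ M k∈

allSubsets-⊥∷nonempty : ∀ k → ∃ λ rest → allSubsets k ≡ ⊥ ∷ rest × All (λ A → 0 < ∣ A ∣) rest
allSubsets-⊥∷nonempty zero = [] , refl , []
allSubsets-⊥∷nonempty (suc k) with allSubsets k | allSubsets-⊥∷nonempty k
... | .(⊥ ∷ rest) | rest , refl , rest-nonempty =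
  map (outside ∷_) rest ++ map (inside ∷_) (⊥ ∷ rest) , refl ,
  All.++⁺ (All.map⁺ rest-nonempty) (All.map⁺ (All.universal (λ _ → s≤s z≤n) (⊥ ∷ rest)))

module _ {c ℓ : Level} (R : CommutativeSemiring c ℓ) where
  open CommutativeSemiring R
    renaming (_+_ to _⊕_; _*_ to _⊛_; refl to ≈-refl; sym to ≈-sym; trans to ≈-trans)

  -- Poly.Σ[_], restated here since Poly is parametrised by a hypergraph.
  ∑ : List Carrier → Carrier
  ∑ = foldr _⊕_ 0#

  ∑-++ : ∀ xs ys → ∑ (xs ++ ys) ≈ ∑ xs ⊕ ∑ ys
  ∑-++ []       ys = ≈-sym (+-identityˡ _)
  ∑-++ (x ∷ xs) ys = ≈-trans (+-congˡ (∑-++ xs ys)) (≈-sym (+-assoc _ _ _))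

  module _ {a} {A : Set a} where

    ∑-concatMap-cong : ∀ {g h : A → List Carrier} xs → (∀ x → ∑ (g x) ≈ ∑ (h x)) →
      ∑ (concatMap g xs) ≈ ∑ (concatMap h xs)
    ∑-concatMap-cong         []       _   = ≈-refl
    ∑-concatMap-cong {g} {h} (x ∷ xs) g≈h = ≈-trans (∑-++ (g x) _)
      (≈-trans (+-cong (g≈h x) (∑-concatMap-cong xs g≈h)) (≈-sym (∑-++ (h x) _)))

    ∑-concatMap-zero : ∀ {g : A → List Carrier} {xs} → All (λ x → ∑ (g x) ≈ 0#) xs →
      ∑ (concatMap g xs) ≈ 0#
    ∑-concatMap-zero         []                = ≈-refl
    ∑-concatMap-zero {g} {x ∷ _} (gx≈0 ∷ rest≈0) =
      ≈-trans (∑-++ (g x) _) (≈-trans (+-cong gx≈0 (∑-concatMap-zero rest≈0)) (+-identityˡ 0#))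

    ∑-concatMap-head : ∀ {g : A → List Carrier} x {xs} → All (λ x → ∑ (g x) ≈ 0#) xs →
      ∑ (concatMap g (x ∷ xs)) ≈ ∑ (g x)
    ∑-concatMap-head {g} x rest≈0 =
      ≈-trans (∑-++ (g x) _) (≈-trans (+-congˡ (∑-concatMap-zero rest≈0)) (+-identityʳ _))

  x*0*y*z≈0 : ∀ a b c → a ⊛ 0# ⊛ b ⊛ c ≈ 0#
  x*0*y*z≈0 a b c = ≈-trans (*-congʳ (≈-trans (*-congʳ (zeroʳ a)) (zeroˡ b))) (zeroˡ c)

  module Summands {n m : ℕ} (e : Fin m → Subset n) (nonempty : ∀ j → Nonempty (e j))
                  (x z : Carrier) (t : Fin m → Carrier) where
    open Hypergraph e
    open Poly R using (pow; prodOver)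
    open SetoidReasoning setoid

    pow-0#-positive : ∀ {k} → 0 < k → pow 0# k ≈ 0#
    pow-0#-positive {suc k} _ = zeroˡ _

    prodOver-scale : ∀ S → prodOver S (λ i → z ⊛ t i) ≈ pow z ∣ S ∣ ⊛ prodOver S t
    prodOver-scale S =
      subst (λ k → prodOver S (λ i → z ⊛ t i) ≈ pow z k ⊛ prodOver S t) (length-elems S) (go (elems S))
      where
      go : ∀ js → foldr (λ i p → (z ⊛ t i) ⊛ p) 1# js ≈ pow z (length js) ⊛ foldr (λ i p → t i ⊛ p) 1# js
      go []       = ≈-sym (*-identityˡ 1#)
      go (j ∷ js) = ≈-trans (*-congˡ (go js)) (interchange z (t j) _ _)
        where open CommutativeSemigroupProperties *-commutativeSemigroup using (interchange)

    ξ-summand : Subset m → Subset m → List Carrier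
    ξ-summand A B = if vertexDisjointPair A B
      then (pow x (kPartial (A ∪ B) ∸ kSection B) ⊛ pow 0# ((∣ A ∣ + ∣ B ∣) ∸ kSection B)
            ⊛ pow z (kSection B) ⊛ prodOver (A ∪ B) t) ∷ []
      else []

    μ-summand : Subset m → List Carrier
    μ-summand M = if isMatching M then (pow x (n ∸ mStar M) ⊛ prodOver M (λ i → z ⊛ t i)) ∷ [] else []

    ξ-summand-vanishes : ∀ {A B} → kSection B < ∣ A ∣ + ∣ B ∣ → ∑ (ξ-summand A B) ≈ 0#
    ξ-summand-vanishes {A} {B} lt with vertexDisjointPair A B
    ... | false = ≈-refl
    ... | true  = ≈-trans (+-identityʳ _)
      (≈-trans (*-congʳ (*-congʳ (*-congˡ (pow-0#-positive (m<n⇒0<n∸m lt))))) (x*0*y*z≈0 _ _ _))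

    ξ-row-vanishes : ∀ {A} → 0 < ∣ A ∣ → ∀ B → ∑ (ξ-summand A B) ≈ 0#
    ξ-row-vanishes {A} 0<∣A∣ B =
      ξ-summand-vanishes {A} {B} (≤-<-trans (kSection≤∣J∣ e nonempty B) (m<n+m ∣ B ∣ 0<∣A∣))

    ξ-rows-vanish : ∀ Bs {As} → All (λ A → 0 < ∣ A ∣) As →
      All (λ A → ∑ (concatMap (ξ-summand A) Bs) ≈ 0#) As
    ξ-rows-vanish Bs = All.map λ {A} 0<∣A∣ →
      ∑-concatMap-zero {g = ξ-summand A} (All.universal (ξ-row-vanishes {A} 0<∣A∣) Bs)

    ξ-summand-⊥ : ∀ B → ∑ (ξ-summand ⊥ B) ≈
      pow x (kPartial B ∸ kSection B) ⊛ pow 0# (∣ B ∣ ∸ kSection B) ⊛ pow z (kSection B) ⊛ prodOver B t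
    ξ-summand-⊥ B rewrite vertexDisjointPair-⊥ˡ e B | ∪-identityˡ B | ∣⊥∣≡0 m = +-identityʳ _

    ξ-row-⊥ : ∀ B → ∑ (ξ-summand ⊥ B) ≈ ∑ (μ-summand B)
    ξ-row-⊥ B with isMatching B in matching
    ... | false = ξ-summand-vanishes {⊥} {B}
      (subst (kSection B <_) (cong (_+ ∣ B ∣) (sym (∣⊥∣≡0 m))) (kSection<∣M∣ e nonempty B matching))
    ... | true  = begin
      ∑ (ξ-summand ⊥ B)
        ≈⟨ ξ-summand-⊥ B ⟩
      pow x (kPartial B ∸ kSection B) ⊛ pow 0# (∣ B ∣ ∸ kSection B) ⊛ pow z (kSection B) ⊛ prodOver B t
        ≡⟨ cong (_⊛ prodOver B t) exponents ⟩
      pow x (n ∸ mStar B) ⊛ 1# ⊛ pow z ∣ B ∣ ⊛ prodOver B t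
        ≈⟨ *-congʳ (*-congʳ (*-identityʳ _)) ⟩
      pow x (n ∸ mStar B) ⊛ pow z ∣ B ∣ ⊛ prodOver B t
        ≈⟨ *-assoc _ _ _ ⟩
      pow x (n ∸ mStar B) ⊛ (pow z ∣ B ∣ ⊛ prodOver B t)
        ≈⟨ *-congˡ (prodOver-scale B) ⟨
      pow x (n ∸ mStar B) ⊛ prodOver B (λ i → z ⊛ t i)
        ≈⟨ +-identityʳ _ ⟨
      ∑ (pow x (n ∸ mStar B) ⊛ prodOver B (λ i → z ⊛ t i) ∷ [])
        ∎
      where
      exponents : pow x (kPartial B ∸ kSection B) ⊛ pow 0# (∣ B ∣ ∸ kSection B) ⊛ pow z (kSection B)
                ≡ pow x (n ∸ mStar B) ⊛ pow 0# 0 ⊛ pow z ∣ B ∣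
      exponents rewrite kPartial∸kSection≡n∸mStar e B matching | kSection≡∣M∣ e nonempty B matching
                      | n∸n≡0 ∣ B ∣ = refl

mainTheorem7 : {c ℓ : Level} (R : CommutativeSemiring c ℓ) (n m : ℕ) (e : Fin m → Subset n)
    → (∀ i → Nonempty (e i))
    → (x z : CommutativeSemiring.Carrier R) (t : Fin m → CommutativeSemiring.Carrier R)
    → CommutativeSemiring._≈_ R
        (Hypergraph.Poly.ξ e R x (CommutativeSemiring.0# R) z t)
        (Hypergraph.Poly.μ e R x (λ i → CommutativeSemiring._*_ R z (t i)))
mainTheorem7 R n m e nonempty x z t with allSubsets m | allSubsets-⊥∷nonempty m
... | .(⊥ ∷ rest) | rest , refl , rest-nonempty = begin
  ∑ R (concatMap (λ A → concatMap (ξ-summand A) (⊥ ∷ rest)) (⊥ ∷ rest))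
    ≈⟨ ∑-concatMap-head R {g = λ A → concatMap (ξ-summand A) (⊥ ∷ rest)} ⊥
         (ξ-rows-vanish (⊥ ∷ rest) rest-nonempty) ⟩
  ∑ R (concatMap (ξ-summand ⊥) (⊥ ∷ rest))
    ≈⟨ ∑-concatMap-cong R {g = ξ-summand ⊥} {h = μ-summand} (⊥ ∷ rest) ξ-row-⊥ ⟩
  ∑ R (concatMap μ-summand (⊥ ∷ rest))
    ∎
  where
  open CommutativeSemiring R using (setoid)
  open SetoidReasoning setoid
  open Summands R e nonempty x z t
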